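{- Let $\mathcal{L}$ be a first-order alphabet, $P$ a definite clause program over $\mathcal{L}$, and $Q$ an atomic query over $\mathcal{L}$. Let $\mathit{magic}(P,Q)$ be the magic program for $P$ and $Q$, defined in the context. Then for every query $R$ (finite conjunction of atoms) over $\mathcal{L}$: if $\mathit{magic}(P,Q)\models R$ then $P\models R$.
   Context: Magic transformation: the alphabet $\mathcal{L}$ is extended with a new predicate symbol $\hat p$ for each predicate symbol $p$ of $\mathcal{L}$; for each $p$ some $k_p$ argument positions $i_1<\dots<i_{k_p}$ of $p$ are selected (arbitrarily, fixed), and $\hat p$ has arity $k_p$. For an atom $A=p(t_1,\dots,t_n)$ over $\mathcal{L}$, $\hat A$ denotes $\hat p(t_{i_1},\dots,t_{i_{k_p}})$. The program $\mathit{magic}(P,Q)$ consists of: (1) a clause $H\gets \hat H, B_1,\dots,B_n$ for each clause $H\gets B_1,\dots,B_n$ of $P$; (2) a clause $\hat B_i\gets \hat H, B_1,\dots,B_{i-1}$ for each clause $H\gets B_1,\dots,B_n$ of $P$ and each $i=1,\dots,n$; (3) the unit clause $\hat Q\gets$. Here $\models$ denotes logical consequence. -}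

module Defs where

open import Level using (Level; suc; zero)
open import Data.Nat using (ℕ)
open import Data.Fin using (Fin; _<_)
open import Data.Vec using (Vec; []; _∷_; lookup)
import Data.Vec as Vec
open import Data.List using (List; []; _∷_; _++_; [_])
import Data.List as List
open import Data.List.Relation.Unary.All using (All)
open import Data.Sum using (_⊎_; inj₁; inj₂)

record Alphabet : Set₁ where
  field
    Fun   : Set
    farity : Fun → ℕ
    Pred  : Set
    parity : Pred → ℕ
open Alphabet public

data Term (F : Set) (ar : F → ℕ) : Set where
  var : ℕ → Term F ar
  fn  : (f : F) → Vec (Term F ar) (ar f) → Term F ar

TermL : Alphabet → Set
TermL L = Term (Fun L) (farity L)

record Atom (L : Alphabet) : Set where
  constructor atom
  field
    pred : Pred L
    args : Vec (TermL L) (parity L pred)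

record Clause (L : Alphabet) : Set where
  constructor _⇐_
  field
    head : Atom L
    body : List (Atom L)

Program : Alphabet → Set
Program L = List (Clause L)

Query : Alphabet → Set
Query L = List (Atom L)

record Interpretation (L : Alphabet) : Set₁ where
  field
    Dom  : Set
    ifun : (f : Fun L) → Vec Dom (farity L f) → Dom
    ipred : (p : Pred L) → Vec Dom (parity L p) → Set
open Interpretation public

module _ {L : Alphabet} (I : Interpretation L) (v : ℕ → Dom I) where
  mutual
    evalT : TermL L → Dom I
    evalT (var x)   = v x
    evalT (fn f ts) = ifun I f (evalTs ts)

    evalTs : ∀ {n} → Vec (TermL L) n → Vec (Dom I) n
    evalTs []       = []
    evalTs (t ∷ ts) = evalT t ∷ evalTs ts

  holdsA : Atom L → Set
  holdsA (atom p ts) = ipred I p (evalTs ts)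

  holdsAll : List (Atom L) → Set
  holdsAll = All holdsA

trueClause : ∀ {L} → Interpretation L → Clause L → Set
trueClause I (h ⇐ bs) = ∀ v → holdsAll I v bs → holdsA I v h

isModel : ∀ {L} → Interpretation L → Program L → Set
isModel I P = All (trueClause I) P

-- A query (with free variables) is true in I iff it holds under every
-- assignment (i.e. its universal closure is true).
trueQuery : ∀ {L} → Interpretation L → Query L → Set
trueQuery I R = ∀ v → holdsAll I v R

_⊨_ : ∀ {L} → Program L → Query L → Set₁
_⊨_ {L} P R = (I : Interpretation L) → isModel I P → trueQuery I R

record Selection (L : Alphabet) : Set where
  field
    k   : Pred L → ℕ
    pos : (p : Pred L) → Vec (Fin (parity L p)) (k p)
    increasing : ∀ p (a b : Fin (k p)) → a < b → lookup (pos p) a < lookup (pos p) b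
open Selection public

-- Extended alphabet: inj₁ p is p, inj₂ p is p̂.
extArity : {L : Alphabet} → Selection L → Pred L ⊎ Pred L → ℕ
extArity {L} S (inj₁ p) = parity L p
extArity S (inj₂ p) = k S p

ext : (L : Alphabet) → Selection L → Alphabet
ext L S = record { Fun = Fun L ; farity = farity L ; Pred = Pred L ⊎ Pred L
                 ; parity = extArity S }

module _ {L : Alphabet} (S : Selection L) where

  lift : Atom L → Atom (ext L S)
  lift (atom p ts) = atom (inj₁ p) ts

  hat : Atom L → Atom (ext L S)
  hat (atom p ts) = atom (inj₂ p) (Vec.map (lookup ts) (pos S p))

  -- clauses  B̂ᵢ ← Ĥ, B₁, …, Bᵢ₋₁  (pre holds the lifted B₁,…,Bᵢ₋₁)
  magicBody : Atom L → List (Atom (ext L S)) → List (Atom L) → Program (ext L S)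
  magicBody H pre []       = []
  magicBody H pre (B ∷ Bs) = (hat B ⇐ (hat H ∷ pre)) ∷ magicBody H (pre ++ [ lift B ]) Bs

  magicClause : Clause L → Program (ext L S)
  magicClause (H ⇐ Bs) = (lift H ⇐ (hat H ∷ List.map lift Bs)) ∷ magicBody H [] Bs

  magic : Program L → Atom L → Program (ext L S)
  magic P Q = List.concatMap magicClause P ++ [ hat Q ⇐ [] ]

-- Expand a model I of P to the extended alphabet by making every magic
-- predicate p̂ true everywhere.  Each clause of magic(P,Q) then either has a
-- magic head (trivially true) or is H ← Ĥ, B₁, …, Bₙ, which holds because
-- H ← B₁, …, Bₙ holds in I; so the expansion is a model of magic(P,Q), and
-- the lifted query, being true there, is true in I.
module Submission where

open import Defs
open import Data.List using ([]; _∷_; map)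
open import Data.List.Relation.Unary.All as All using (All; []; _∷_)
open import Data.List.Relation.Unary.All.Properties using (++⁺; concat⁺; map⁺; map⁻)
open import Data.Sum using (_⊎_; inj₁; inj₂)
open import Data.Unit using (⊤; tt)
open import Data.Vec using (Vec; []; _∷_)
open import Function using (_∘′_)
open import Relation.Binary.PropositionalEquality using (_≡_; refl; cong; cong₂; subst; sym)

module Expansion {L : Alphabet} (S : Selection L) (I : Interpretation L) where

  expandPred : (p : Pred L ⊎ Pred L) → Vec (Dom I) (extArity S p) → Set
  expandPred (inj₁ p) = ipred I p
  expandPred (inj₂ p) = λ _ → ⊤

  expand : Interpretation (ext L S)
  expand = record { Dom = Dom I ; ifun = ifun I ; ipred = expandPred }

  mutual
    evalT-expand : ∀ v t → evalT expand v t ≡ evalT I v t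
    evalT-expand v (var x)   = refl
    evalT-expand v (fn f ts) = cong (ifun I f) (evalTs-expand v ts)

    evalTs-expand : ∀ v {n} (ts : Vec (TermL L) n) → evalTs expand v ts ≡ evalTs I v ts
    evalTs-expand v []       = refl
    evalTs-expand v (t ∷ ts) = cong₂ _∷_ (evalT-expand v t) (evalTs-expand v ts)

  holdsA-lift⁺ : ∀ v a → holdsA I v a → holdsA expand v (lift S a)
  holdsA-lift⁺ v (atom p ts) = subst (ipred I p) (sym (evalTs-expand v ts))

  holdsA-lift⁻ : ∀ v a → holdsA expand v (lift S a) → holdsA I v a
  holdsA-lift⁻ v (atom p ts) = subst (ipred I p) (evalTs-expand v ts)

  holdsAll-lift⁻ : ∀ v as → holdsAll expand v (map (lift S) as) → holdsAll I v as
  holdsAll-lift⁻ v as = All.map (holdsA-lift⁻ v _) ∘′ map⁻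

  holdsA-hat : ∀ v a → holdsA expand v (hat S a)
  holdsA-hat v (atom p ts) = tt

  magicBody-true : ∀ H pre Bs → All (trueClause expand) (magicBody S H pre Bs)
  magicBody-true H pre []       = []
  magicBody-true H pre (B ∷ Bs) = (λ v _ → holdsA-hat v B) ∷ magicBody-true H _ Bs

  magicClause-true : ∀ c → trueClause I c → All (trueClause expand) (magicClause S c)
  magicClause-true (H ⇐ Bs) H⇐Bs =
    (λ { v (_ ∷ Bs-hold) → holdsA-lift⁺ v H (H⇐Bs v (holdsAll-lift⁻ v Bs Bs-hold)) })
    ∷ magicBody-true H [] Bs

  magic-isModel : ∀ P Q → isModel I P → isModel expand (magic S P Q)
  magic-isModel P Q I⊨P =
    ++⁺ (concat⁺ (map⁺ (All.map (magicClause-true _) I⊨P)))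
        ((λ v _ → holdsA-hat v Q) ∷ [])

lemma1 : (L : Alphabet) (S : Selection L) (P : Program L) (Q : Atom L) (R : Query L) →
           magic S P Q ⊨ map (lift S) R → P ⊨ R
lemma1 L S P Q R magic⊨R I I⊨P v =
  holdsAll-lift⁻ v R (magic⊨R expand (magic-isModel P Q I⊨P) v)
  where open Expansion S I
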